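{- Assume that a class of graphs $\mathcal{C}$ has a finite weak coloring number $\mathrm{wcol}_d(\mathcal{C})$ for each $d \geq 1$. Then $\mathcal{C}$ is also uniformly quasi-wide with margins $$N(m, d) = (\mathrm{wcol}_d(\mathcal{C}))!\,(m+1)^{\mathrm{wcol}_d(\mathcal{C}) + 1}, \quad s(d) = \mathrm{wcol}_d(\mathcal{C}) \quad \text{for each }d \geq 1,\, m \geq 2.$$
   Context: Graphs are finite, undirected, without loops or multiple edges. For a graph $G$, a permutation (linear order) $\sigma$ of $V(G)$, and a distance $d \geq 1$, a vertex $v$ is weakly $d$-reachable from $u$ with respect to $\sigma$ if $v$ is not after $u$ in $\sigma$ and there exists a path of length at most $d$ connecting $u$ and $v$ on which $v$ is the minimum vertex with respect to $\sigma$ (in particular $u$ is weakly $d$-reachable from itself). Let $\mathrm{WReach}_d[G,\sigma,u]$ be the set of vertices weakly $d$-reachable from $u$. Define $\mathrm{wcol}_d(G,\sigma) = \max_{u\in V(G)} |\mathrm{WReach}_d[G,\sigma,u]|$, the weak $d$-coloring number $\mathrm{wcol}_d(G) = \min_{\sigma} \mathrm{wcol}_d(G,\sigma)$, and for a class $\mathcal{C}$, $\mathrm{wcol}_d(\mathcal{C}) = \sup_{G \in \mathcal{C}} \mathrm{wcol}_d(G)$. A class $\mathcal{C}$ of graphs is uniformly quasi-wide with margins $N:\mathbb{N}\times\mathbb{N}\to\mathbb{N}$ and $s:\mathbb{N}\to\mathbb{N}$ if for every $m, d \geq 1$, every graph $G \in \mathcal{C}$ and every subset $A \subseteq V(G)$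 with $|A| \geq N(m,d)$, there exist a set $S \subseteq V(G)$ with $|S| \leq s(d)$ and a subset $B \subseteq A \setminus S$ with $|B| \geq m$ which is a distance-$d$ independent set in $G - S$ (i.e., any two distinct vertices of $B$ are at distance greater than $d$ in $G - S$). -}

module Defs where

open import Data.Nat using (ℕ; zero; suc; _≤_; _!; _^_; _*_; _+_)
open import Data.Bool using (Bool; true; false)
open import Data.Fin using (Fin) renaming (_≤_ to _≤ᶠ_)
open import Data.Fin.Subset using (Subset; _∈_; _∉_; _⊆_; _─_; ∣_∣)
open import Data.Fin.Permutation using (Permutation′; _⟨$⟩ʳ_)
open import Data.List using (List; []; _∷_; length)
open import Data.List.Relation.Unary.All using (All)
open import Data.List.Relation.Unary.Unique.Propositional using (Unique)
import Data.List.Membership.Propositional as LM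
open import Data.Product using (Σ; ∃; _×_; _,_)
open import Relation.Binary.PropositionalEquality using (_≡_)
open import Relation.Nullary using (¬_)

record Graph : Set where
  field
    n     : ℕ
    adj   : Fin n → Fin n → Bool
    sym   : ∀ u v → adj u v ≡ adj v u
    loopless : ∀ u → adj u u ≡ false

open Graph public

V : Graph → Set
V G = Fin (n G)

Adj : (G : Graph) → V G → V G → Set
Adj G u v = adj G u v ≡ true

Class : Set₁
Class = Graph → Set

-- Walk G u v vs : vs is the vertex sequence of a walk from u to v
-- (so the walk has length  length vs - 1).
data Walk (G : Graph) : V G → V G → List (V G) → Set where
  here : ∀ {u} → Walk G u u (u ∷ [])
  step : ∀ {u w v vs} → Adj G u w → Walk G w v vs → Walk G u v (u ∷ vs)

-- A path of length at most d from u to v, given by its vertex sequence vs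
-- (no repeated vertices, at most d+1 vertices).
ShortPath : (G : Graph) → ℕ → V G → V G → List (V G) → Set
ShortPath G d u v vs = Walk G u v vs × Unique vs × length vs ≤ suc d

-- Linear orders on V(G) are given by permutations σ : V(G) ↔ Fin n,
-- σ(v) being the position of v;  x ≤σ y  iff  σ(x) ≤ σ(y).
Order : Graph → Set
Order G = Permutation′ (n G)

OrdLe : (G : Graph) → Order G → V G → V G → Set
OrdLe G σ x y = (σ ⟨$⟩ʳ x) ≤ᶠ (σ ⟨$⟩ʳ y)

WReach : (G : Graph) → ℕ → Order G → V G → V G → Set
WReach G d σ u v =
  OrdLe G σ v u ×
  ∃ λ (vs : List (V G)) → ShortPath G d u v vs × All (λ x → OrdLe G σ v x) vs

-- |P| ≤ c for a predicate P on a finite type: P is covered by a list of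
-- length at most c.
CardLe : {A : Set} → (A → Set) → ℕ → Set
CardLe {A} P c = ∃ λ (xs : List A) → length xs ≤ c × (∀ x → P x → LM._∈_ x xs)

WcolOrdLe : (G : Graph) → ℕ → Order G → ℕ → Set
WcolOrdLe G d σ c = ∀ u → CardLe (WReach G d σ u) c

WcolLe : (G : Graph) → ℕ → ℕ → Set
WcolLe G d c = ∃ λ σ → WcolOrdLe G d σ c

-- wcol_d(C) = w : w is the least upper bound of wcol_d(G) over G ∈ C
-- (in particular the supremum is finite).
IsWcolClass : Class → ℕ → ℕ → Set
IsWcolClass C d w =
  (∀ G → C G → WcolLe G d w) ×
  (∀ c → (∀ G → C G → WcolLe G d c) → w ≤ c)

-- dist_{G - S}(x, y) > d : no path of length ≤ d from x to y avoiding S.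
FarApart : (G : Graph) → ℕ → Subset (n G) → V G → V G → Set
FarApart G d S x y =
  ¬ (∃ λ (vs : List (V G)) → ShortPath G d x y vs × All (λ z → z ∉ S) vs)

DistIndep : (G : Graph) → ℕ → Subset (n G) → Subset (n G) → Set
DistIndep G d S B = ∀ x y → x ∈ B → y ∈ B → ¬ (x ≡ y) → FarApart G d S x y

UQWWith : (ℕ → ℕ → Set) → Class → (ℕ → ℕ → ℕ) → (ℕ → ℕ) → Set
UQWWith Ok C N s =
  ∀ m d → Ok m d → ∀ G → C G → ∀ (A : Subset (n G)) → N m d ≤ ∣ A ∣ →
    ∃ λ (S : Subset (n G)) → ∃ λ (B : Subset (n G)) →
      ∣ S ∣ ≤ s d × B ⊆ (A ─ S) × m ≤ ∣ B ∣ × DistIndep G d S B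

M2D1 : ℕ → ℕ → Set
M2D1 m d = 2 ≤ m × 1 ≤ d

module Submission where

-- Fix an order σ with |WReach_d[G,σ,u]| ≤ k for all u and let W u be a list of at
-- most k vertices containing WReach_d[G,σ,u], so u ∈ W u.  On a path of length ≤ d
-- from x to y the σ-least vertex lies in W x ∩ W y.  Hence it suffices to find S
-- with |S| ≤ k and m vertices of A outside S whose sets W pairwise meet only inside
-- S.  Induct on (m, k): take a ∈ A; either many b have W b disjoint from W a (keep
-- a, recurse on those b), or by pigeonhole some u ∈ W a lies in W b for many b (put
-- u into S, delete it from every W b, so the bound drops to k - 1).  The margin
-- k! (m+1)^(k+1) pays for both branches.

open import Defs
open import Data.Nat using (ℕ; zero; suc; _≤_; _<_; _!; _^_; _*_; _+_; z≤n; s≤s)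
open import Data.Nat.Properties hiding (_≟_; suc-injective)
open import Data.Nat.Tactic.RingSolver using (solve-∀)
open import Data.Bool using (true; false)
open import Data.Fin using (Fin; _≟_; toℕ) renaming (zero to fzero; suc to fsuc)
open import Data.Fin.Properties using (suc-injective)
open import Data.Fin.Permutation using (_⟨$⟩ʳ_)
open import Data.Fin.Subset
  using (Subset; ⁅_⁆; _∪_; ⊥; _─_; ∣_∣) renaming (_∈_ to _∈ₛ_; _∉_ to _∉ₛ_; _⊆_ to _⊆ₛ_)
open import Data.Fin.Subset.Properties using (x∈p∪q⁺; x∈p∪q⁻; x∈⁅x⁆; x∈⁅y⁆⇒x≡y; ∉⊥)
open import Data.Vec.Base as Vec using ([]; _∷_)
open import Data.List using (List; []; _∷_; length; filter; map; reverse; _∷ʳ_)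
open import Data.List.Properties using (filter-notAll; unfold-reverse; length-reverse; length-map)
open import Data.List.Extrema.Nat using (argmin; argmin-sel; f[argmin]≤f[⊤]; f[argmin]≤f[xs])
open import Data.List.Relation.Unary.Any as Any using (Any; here; there; any?)
import Data.List.Relation.Unary.Any.Properties as Any
open import Data.List.Relation.Unary.All as All using (All; []; _∷_)
open import Data.List.Relation.Unary.AllPairs as AllPairs using ([]; _∷_)
open import Data.List.Relation.Unary.Unique.Propositional using (Unique)
import Data.List.Relation.Unary.Unique.Propositional.Properties as Unique
open import Data.List.Relation.Binary.Subset.Propositional using (_⊆_)
open import Data.List.Relation.Binary.Subset.Propositional.Properties using (∷⁺ʳ; filter-⊆)
open import Data.List.Relation.Binary.Permutation.Propositional using (↭-sym; ↭⇒↭ₛ)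
open import Data.List.Relation.Binary.Permutation.Propositional.Properties using (↭-reverse; All-resp-↭)
import Data.List.Relation.Binary.Permutation.Setoid.Properties as PermutationSetoid
open import Data.List.Membership.Propositional using (_∈_; _∉_; lose)
open import Data.List.Membership.Propositional.Properties using (∈-filter⁺; ∈-filter⁻; ∈-length; ∈-map⁺; ∈-map⁻)
import Data.List.Membership.DecPropositional as DecMembership
import Data.List.Relation.Binary.Sublist.Propositional as Sublist
import Data.List.Relation.Binary.Sublist.Propositional.Properties as Sublist
open import Data.Product using (∃-syntax; _×_; _,_; proj₁; proj₂)
open import Data.Sum using (inj₁; inj₂)
open import Data.Empty using (⊥-elim)
open import Function using (id; _∘_; case_of_)
open import Relation.Binary.Definitions using (DecidableEquality)
open import Relation.Binary.PropositionalEquality as ≡ using (_≡_; _≢_; refl)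
open import Relation.Nullary using (¬_; yes; no)
open import Relation.Unary using (Decidable)
open import Relation.Unary.Properties using (∁?)

-- A closed-form solution of T (k+1) (p+1) > T (k+1) p + (k+1) * T k (p+1), the
-- recursion of the separation argument.
margin : ℕ → ℕ → ℕ
margin k p = k ! * (p + 1) ^ (k + 1)

1≤margin : ∀ k p → 1 ≤ margin k p
1≤margin k p rewrite +-comm p 1 = *-mono-≤ (1≤n! k) (m^n>0 (suc p) (k + 1))

^-suc-≥ : ∀ q e → q ^ suc e + 1 ≤ suc q ^ suc e
^-suc-≥ q e = begin
  q * q ^ e + 1               ≤⟨ +-mono-≤ (*-monoʳ-≤ q (^-monoˡ-≤ e (n≤1+n q))) (m^n>0 (suc q) e) ⟩
  q * suc q ^ e + suc q ^ e   ≡⟨ +-comm (q * suc q ^ e) _ ⟩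
  suc q ^ suc e               ∎
  where open ≤-Reasoning

margin-step : ∀ k p → margin (suc k) p + suc k * margin k (suc p) + 1 ≤ margin (suc k) (suc p)
margin-step k p = begin
  K * F * (q * X) + K * (F * Z) + 1  ≡⟨ regroup K F q X Z ⟩
  (c * X + 1) + K * F * Z            ≤⟨ +-monoˡ-≤ (K * F * Z) cX+1≤cZ ⟩
  c * Z + K * F * Z                  ≡⟨ factor K F q Z ⟩
  K * F * (suc q * Z)                ∎
  where
  open ≤-Reasoning
  K = suc k
  F = k !
  q = p + 1
  X = q ^ (k + 1)
  Z = suc q ^ (k + 1)
  c = K * F * q
  regroup : ∀ K F q X Z → K * F * (q * X) + K * (F * Z) + 1 ≡ (K * F * q * X + 1) + K * F * Z
  regroup = solve-∀
  factor : ∀ K F q Z → K * F * q * Z + K * F * Z ≡ K * F * (suc q * Z)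
  factor = solve-∀
  X+1≤Z : X + 1 ≤ Z
  X+1≤Z rewrite +-comm k 1 = ^-suc-≥ q k
  cX+1≤cZ : c * X + 1 ≤ c * Z
  cX+1≤cZ = begin
    c * X + 1  ≤⟨ +-monoʳ-≤ (c * X) (*-mono-≤ (*-mono-≤ {1} {K} (s≤s z≤n) (1≤n! k)) (m≤n+m 1 p)) ⟩
    c * X + c  ≡⟨ ≡.cong (c * X +_) (≡.sym (*-identityʳ c)) ⟩
    c * X + c * 1  ≡⟨ ≡.sym (*-distribˡ-+ c X 1) ⟩
    c * (X + 1)    ≤⟨ *-monoʳ-≤ c X+1≤Z ⟩
    c * Z          ∎

margin-split : ∀ {k p m n} → margin (suc k) (suc p) ≤ suc (m + n) → n < margin (suc k) p →
               suc k * margin k (suc p) < m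
margin-split {k} {p} {m} {n} big small = +-cancelˡ-≤ n _ _ (begin
  n + suc b  ≡⟨ +-suc n b ⟩
  suc n + b  ≤⟨ +-monoˡ-≤ b small ⟩
  a + b      ≤⟨ ≤-pred (≤-trans (≤-reflexive (+-comm 1 (a + b))) (≤-trans (margin-step k p) big)) ⟩
  m + n      ≡⟨ +-comm m n ⟩
  n + m      ∎)
  where
  open ≤-Reasoning
  a = margin (suc k) p
  b = suc k * margin k (suc p)

length-filter-∁ : ∀ {A : Set} {P : A → Set} (P? : Decidable P) xs →
                  length (filter P? xs) + length (filter (∁? P?) xs) ≡ length xs
length-filter-∁ P? [] = refl
length-filter-∁ P? (x ∷ xs) with P? x
... | yes _ = ≡.cong suc (length-filter-∁ P? xs)
... | no _  = ≡.trans (+-suc _ _) (≡.cong suc (length-filter-∁ P? xs))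

pigeonhole : ∀ {A B : Set} {R : A → B → Set} (R? : ∀ u → Decidable (R u)) q (U : List A) (M : List B) →
             All (λ b → Any (λ u → R u b) U) M → length U * q < length M →
             ∃[ u ] u ∈ U × q < length (filter (R? u) M)
pigeonhole R? q [] [] _ ()
pigeonhole R? q [] (b ∷ M) (() ∷ _) _
pigeonhole {R = R} R? q (u ∷ U) M covered many with q <? length (filter (R? u) M)
... | yes more = u , here refl , more
... | no fewer with pigeonhole R? q U (filter (∁? (R? u)) M) covered′ many′
  where
  covered′ : All (λ b → Any (λ u → R u b) U) (filter (∁? (R? u)) M)
  covered′ = All.tabulate λ b∈ → let (b∈M , ¬Rub) = ∈-filter⁻ (∁? (R? u)) b∈ in
    Any.tail ¬Rub (All.lookup covered b∈M)
  many′ : length U * q < length (filter (∁? (R? u)) M)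
  many′ = +-cancelˡ-< q _ _ (begin-strict
    q + length U * q  <⟨ many ⟩
    length M          ≡⟨ ≡.sym (length-filter-∁ (R? u) M) ⟩
    length (filter (R? u) M) + length (filter (∁? (R? u)) M)  ≤⟨ +-monoˡ-≤ _ (≮⇒≥ fewer) ⟩
    q + length (filter (∁? (R? u)) M)  ∎)
    where open ≤-Reasoning
... | u′ , u′∈U , more = u′ , there u′∈U , ≤-trans more (Sublist.length-mono-≤ filtered⊆)
  where
  filtered⊆ : filter (R? u′) (filter (∁? (R? u)) M) Sublist.⊆ filter (R? u′) M
  filtered⊆ = Sublist.filter⁺ (R? u′) (R? u′) (λ { refl r → r }) (Sublist.filter-⊆ (∁? (R? u)) M)

module _ {A : Set} (_≟ᴬ_ : DecidableEquality A) where
  open DecMembership _≟ᴬ_ using (_∈?_)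

  remove : A → List A → List A
  remove u = filter (∁? (_≟ᴬ u))

  ∈-remove⁺ : ∀ {u x xs} → x ∈ xs → x ≢ u → x ∈ remove u xs
  ∈-remove⁺ {u} = ∈-filter⁺ (∁? (_≟ᴬ u))

  ∈-remove⁻ : ∀ {u x} xs → x ∈ remove u xs → x ∈ xs × x ≢ u
  ∈-remove⁻ {u} xs = ∈-filter⁻ (∁? (_≟ᴬ u)) {xs = xs}

  length-remove-< : ∀ {u xs} → u ∈ xs → length (remove u xs) < length xs
  length-remove-< {u} {xs} u∈ = filter-notAll (∁? (_≟ᴬ u)) xs (Any.map (λ u≡x x≢u → x≢u (≡.sym u≡x)) u∈)

  ⊆-∷-remove : ∀ u xs → xs ⊆ u ∷ remove u xs
  ⊆-∷-remove u xs {x} x∈ with x ≟ᴬ u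
  ... | yes refl = here refl
  ... | no x≢u   = there (∈-remove⁺ x∈ x≢u)

  unique-⊆⇒length≤ : ∀ {xs ys} → Unique xs → xs ⊆ ys → length xs ≤ length ys
  unique-⊆⇒length≤ {[]}     _              _   = z≤n
  unique-⊆⇒length≤ {x ∷ xs} {ys} (x∉ ∷ uxs) sub =
    ≤-trans (s≤s (unique-⊆⇒length≤ uxs xs⊆ys-x)) (length-remove-< (sub (here refl)))
    where
    xs⊆ys-x : xs ⊆ remove x ys
    xs⊆ys-x y∈ = ∈-remove⁺ (sub (there y∈)) (λ y≡x → All.lookup x∉ y∈ (≡.sym y≡x))

  Meets : (A → List A) → A → A → Set
  Meets W a b = Any (_∈ W b) (W a)

  meets? : (W : A → List A) (a : A) → Decidable (Meets W a)
  meets? W a b = any? (_∈? W b) (W a)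

  -- separator⊆⋃W is the invariant that keeps a newly added isolated member
  -- out of the separator.
  record Separated (W : A → List A) (L : List A) (k p : ℕ) : Set where
    field
      separator members  : List A
      separator-small    : length separator ≤ k
      members-large      : p ≤ length members
      members-unique     : Unique members
      members⊆L          : members ⊆ L
      members-avoid      : ∀ {x} → x ∈ members → x ∉ separator
      separator⊆⋃W       : ∀ {y} → y ∈ separator → ∃[ b ] b ∈ L × y ∈ W b
      separates          : ∀ {x y z} → x ∈ members → y ∈ members → x ≢ y →
                           z ∈ W x → z ∈ W y → z ∈ separator

  open Separated

  separated-zero : ∀ {W L k} → Separated W L k 0
  separated-zero = record
    { separator = [] ; members = [] ; separator-small = z≤n ; members-large = z≤n
    ; members-unique = [] ; members⊆L = λ () ; members-avoid = λ ()
    ; separator⊆⋃W = λ () ; separates = λ () }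

  separated-mono : ∀ {W L L′ k p} → L ⊆ L′ → Separated W L k p → Separated W L′ k p
  separated-mono L⊆L′ s = record
    { separator = separator s
    ; members = members s
    ; separator-small = separator-small s
    ; members-large = members-large s
    ; members-unique = members-unique s
    ; members⊆L = L⊆L′ ∘ members⊆L s
    ; members-avoid = members-avoid s
    ; separator⊆⋃W = λ y∈ → let (b , b∈L , y∈Wb) = separator⊆⋃W s y∈ in b , L⊆L′ b∈L , y∈Wb
    ; separates = separates s
    }

  separated-isolated : ∀ {W a L k p} → a ∈ W a → a ∉ L → (∀ {b} → b ∈ L → ¬ Meets W a b) →
                       Separated W L k p → Separated W (a ∷ L) k (suc p)
  separated-isolated {W} {a} {L} a∈Wa a∉L isolated s = record
    { separator = separator s
    ; members = a ∷ members s
    ; separator-small = separator-small s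
    ; members-large = s≤s (members-large s)
    ; members-unique = All.tabulate (λ x∈ a≡x → a∉L (≡.subst (_∈ L) (≡.sym a≡x) (members⊆L s x∈)))
                       ∷ members-unique s
    ; members⊆L = λ { (here refl) → here refl ; (there x∈) → there (members⊆L s x∈) }
    ; members-avoid = λ { (here refl) → a∉separator ; (there x∈) → members-avoid s x∈ }
    ; separator⊆⋃W = λ y∈ → let (b , b∈L , y∈Wb) = separator⊆⋃W s y∈ in b , there b∈L , y∈Wb
    ; separates = separates′
    }
    where
    a∉separator : a ∉ separator s
    a∉separator a∈ = let (b , b∈L , a∈Wb) = separator⊆⋃W s a∈ in isolated b∈L (lose a∈Wa a∈Wb)
    separates′ : ∀ {x y z} → x ∈ a ∷ members s → y ∈ a ∷ members s → x ≢ y →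
                 z ∈ W x → z ∈ W y → z ∈ separator s
    separates′ (here refl) (here refl) x≢y _ _ = ⊥-elim (x≢y refl)
    separates′ (here refl) (there y∈) _ z∈Wa z∈Wy = ⊥-elim (isolated (members⊆L s y∈) (lose z∈Wa z∈Wy))
    separates′ (there x∈) (here refl) _ z∈Wx z∈Wa = ⊥-elim (isolated (members⊆L s x∈) (lose z∈Wa z∈Wx))
    separates′ (there x∈) (there y∈) x≢y = separates s x∈ y∈ x≢y

  separated-hub : ∀ {W a u L k p} → u ∈ W a → (∀ {b} → b ∈ L → b ≢ u) →
                  Separated (remove u ∘ W) L k p → Separated W (a ∷ L) (suc k) p
  separated-hub {W} {a} {u} {L} u∈Wa avoid s = record
    { separator = u ∷ separator s
    ; members = members s
    ; separator-small = s≤s (separator-small s)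
    ; members-large = members-large s
    ; members-unique = members-unique s
    ; members⊆L = there ∘ members⊆L s
    ; members-avoid = λ { x∈ (here x≡u) → avoid (members⊆L s x∈) x≡u ; x∈ (there x∈sep) → members-avoid s x∈ x∈sep }
    ; separator⊆⋃W = λ { (here refl) → a , here refl , u∈Wa
                       ; (there y∈) → let (b , b∈L , y∈Wb) = separator⊆⋃W s y∈ in
                                      b , there b∈L , proj₁ (∈-remove⁻ (W b) y∈Wb) }
    ; separates = separates′
    }
    where
    separates′ : ∀ {x y z} → x ∈ members s → y ∈ members s → x ≢ y →
                 z ∈ W x → z ∈ W y → z ∈ u ∷ separator s
    separates′ {z = z} x∈ y∈ x≢y z∈Wx z∈Wy with z ≟ᴬ u
    ... | yes refl = here refl
    ... | no z≢u   = there (separates s x∈ y∈ x≢y (∈-remove⁺ z∈Wx z≢u) (∈-remove⁺ z∈Wy z≢u))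

  record Family (W : A → List A) (L : List A) (k : ℕ) : Set where
    field
      distinct  : Unique L
      reflexive : ∀ {a} → a ∈ L → a ∈ W a
      bounded   : ∀ {a} → a ∈ L → length (W a) ≤ k

  open Family

  Family-⊆ : ∀ {W L L′ k} → Unique L′ → L′ ⊆ L → Family W L k → Family W L′ k
  Family-⊆ uL′ L′⊆L fam = record
    { distinct = uL′ ; reflexive = reflexive fam ∘ L′⊆L ; bounded = bounded fam ∘ L′⊆L }

  Family-filter : ∀ {W L k} {P : A → Set} (P? : Decidable P) → Family W L k → Family W (filter P? L) k
  Family-filter {L = L} P? fam = Family-⊆ (Unique.filter⁺ P? (distinct fam)) (filter-⊆ P? L) fam

  Family-remove : ∀ {W L k u} → (∀ {b} → b ∈ L → u ∈ W b) → Family W L (suc k) →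
                  Family (remove u ∘ W) (remove u L) k
  Family-remove {L = L} {u = u} u∈W fam = record
    { distinct  = Unique.filter⁺ (∁? (_≟ᴬ u)) (distinct fam)
    ; reflexive = λ b∈ → let (b∈L , b≢u) = ∈-remove⁻ L b∈ in ∈-remove⁺ (reflexive fam b∈L) b≢u
    ; bounded   = λ b∈ → let b∈L = proj₁ (∈-remove⁻ L b∈) in
                    ≤-pred (≤-trans (length-remove-< (u∈W b∈L)) (bounded fam b∈L))
    }

  separated : ∀ p k {W L} → Family W L k → margin k p ≤ length L → Separated W L k p
  separated zero    k       _   _   = separated-zero
  separated (suc p) k       {L = []} _ big = ⊥-elim (<⇒≱ (1≤margin k (suc p)) big)
  separated (suc p) zero    {L = a ∷ L} fam _ =
    ⊥-elim (<⇒≱ (∈-length (reflexive fam (here refl))) (bounded fam (here refl)))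
  separated (suc p) (suc k) {W} {a ∷ L} fam big =
    case margin (suc k) p ≤? length I of λ where
      (yes many) → separated-mono (∷⁺ʳ a (filter-⊆ isolated? L)) (by-isolation many)
      (no few)   → let (u , u∈Wa , more) = pigeonhole (λ u b → u ∈? W b) (margin k (suc p)) (W a) M
                                             (All.tabulate (proj₂ ∘ ∈-filter⁻ (meets? W a) {xs = L}))
                                             (many-meet few)
                   in separated-mono (∷⁺ʳ a (hub⊆L u)) (by-hub u u∈Wa more)
    where
    famL : Family W L (suc k)
    famL = Family-⊆ (AllPairs.tail (distinct fam)) there fam
    isolated? = ∁? (meets? W a)
    I = filter isolated? L
    M = filter (meets? W a) L

    by-isolation : margin (suc k) p ≤ length I → Separated W (a ∷ I) (suc k) (suc p)
    by-isolation many =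
      separated-isolated (reflexive fam (here refl))
        (Unique.Unique[x∷xs]⇒x∉xs (distinct fam) ∘ filter-⊆ isolated? L)
        (proj₂ ∘ ∈-filter⁻ isolated? {xs = L})
        (separated p (suc k) (Family-filter isolated? famL) many)

    many-meet : ¬ margin (suc k) p ≤ length I → length (W a) * margin k (suc p) < length M
    many-meet few = ≤-<-trans (*-monoˡ-≤ (margin k (suc p)) (bounded fam (here refl)))
      (margin-split {k} {p} (≤-trans big (≤-reflexive (≡.cong suc L≡M+I))) (≰⇒> few))
      where
      L≡M+I : length L ≡ length M + length I
      L≡M+I = ≡.sym (length-filter-∁ (meets? W a) L)

    hub : A → List A
    hub u = remove u (filter (λ b → u ∈? W b) M)

    hub⊆L : ∀ u → hub u ⊆ L
    hub⊆L u = filter-⊆ (meets? W a) L ∘ filter-⊆ (λ b → u ∈? W b) M ∘ proj₁ ∘ ∈-remove⁻ _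

    by-hub : ∀ u → u ∈ W a → margin k (suc p) < length (filter (λ b → u ∈? W b) M) →
             Separated W (a ∷ hub u) (suc k) (suc p)
    by-hub u u∈Wa more =
      separated-hub u∈Wa (proj₂ ∘ ∈-remove⁻ F)
        (separated (suc p) k (Family-remove (proj₂ ∘ ∈-filter⁻ (λ b → u ∈? W b) {xs = M}) famF) enough)
      where
      F = filter (λ b → u ∈? W b) M
      famF : Family W F (suc k)
      famF = Family-filter (λ b → u ∈? W b) (Family-filter (meets? W a) famL)
      enough : margin k (suc p) ≤ length (hub u)
      enough = ≤-pred (≤-trans more (unique-⊆⇒length≤ (distinct famF) (⊆-∷-remove u F)))

toList : ∀ {k} → Subset k → List (Fin k)
toList []          = []
toList (true ∷ p)  = fzero ∷ map fsuc (toList p)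
toList (false ∷ p) = map fsuc (toList p)

∣p∣≡length[toList] : ∀ {k} (p : Subset k) → ∣ p ∣ ≡ length (toList p)
∣p∣≡length[toList] []          = refl
∣p∣≡length[toList] (true ∷ p)  = ≡.cong suc (≡.trans (∣p∣≡length[toList] p) (≡.sym (length-map fsuc (toList p))))
∣p∣≡length[toList] (false ∷ p) = ≡.trans (∣p∣≡length[toList] p) (≡.sym (length-map fsuc (toList p)))

toList-unique : ∀ {k} (p : Subset k) → Unique (toList p)
toList-unique []          = []
toList-unique (true ∷ p)  = All.tabulate zero∉ ∷ Unique.map⁺ suc-injective (toList-unique p)
  where
  zero∉ : ∀ {y} → y ∈ map fsuc (toList p) → fzero ≢ y
  zero∉ y∈ with ∈-map⁻ fsuc y∈
  ... | _ , _ , refl = λ ()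
toList-unique (false ∷ p) = Unique.map⁺ suc-injective (toList-unique p)

∈-toList⁺ : ∀ {k} {x : Fin k} (p : Subset k) → x ∈ₛ p → x ∈ toList p
∈-toList⁺ (true ∷ p)  Vec.here        = here refl
∈-toList⁺ (true ∷ p)  (Vec.there x∈)  = there (∈-map⁺ fsuc (∈-toList⁺ p x∈))
∈-toList⁺ (false ∷ p) (Vec.there x∈)  = ∈-map⁺ fsuc (∈-toList⁺ p x∈)

∈-toList⁻ : ∀ {k} {x : Fin k} (p : Subset k) → x ∈ toList p → x ∈ₛ p
∈-toList⁻ (true ∷ p) (here refl) = Vec.here
∈-toList⁻ (true ∷ p) (there x∈) with ∈-map⁻ fsuc x∈
... | _ , y∈ , refl = Vec.there (∈-toList⁻ p y∈)
∈-toList⁻ (false ∷ p) x∈ with ∈-map⁻ fsuc x∈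
... | _ , y∈ , refl = Vec.there (∈-toList⁻ p y∈)

fromList : ∀ {k} → List (Fin k) → Subset k
fromList []       = ⊥
fromList (x ∷ xs) = ⁅ x ⁆ ∪ fromList xs

∈-fromList⁺ : ∀ {k} {x : Fin k} {xs} → x ∈ xs → x ∈ₛ fromList xs
∈-fromList⁺ {x = x} (here refl) = x∈p∪q⁺ (inj₁ (x∈⁅x⁆ x))
∈-fromList⁺ (there x∈)         = x∈p∪q⁺ (inj₂ (∈-fromList⁺ x∈))

∈-fromList⁻ : ∀ {k} {x : Fin k} xs → x ∈ₛ fromList xs → x ∈ xs
∈-fromList⁻ []       x∈ = ⊥-elim (∉⊥ x∈)
∈-fromList⁻ (y ∷ xs) x∈ with x∈p∪q⁻ ⁅ y ⁆ (fromList xs) x∈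
... | inj₁ x∈⁅y⁆ = here (x∈⁅y⁆⇒x≡y y x∈⁅y⁆)
... | inj₂ x∈xs  = there (∈-fromList⁻ xs x∈xs)

∣fromList∣≤length : ∀ {k} (xs : List (Fin k)) → ∣ fromList xs ∣ ≤ length xs
∣fromList∣≤length xs = ≤-trans (≤-reflexive (∣p∣≡length[toList] (fromList xs)))
  (unique-⊆⇒length≤ _≟_ (toList-unique (fromList xs)) (∈-fromList⁻ xs ∘ ∈-toList⁻ (fromList xs)))

length≤∣fromList∣ : ∀ {k} {xs : List (Fin k)} → Unique xs → length xs ≤ ∣ fromList xs ∣
length≤∣fromList∣ {xs = xs} uxs = ≤-trans
  (unique-⊆⇒length≤ _≟_ uxs (∈-toList⁺ (fromList xs) ∘ ∈-fromList⁺))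
  (≤-reflexive (≡.sym (∣p∣≡length[toList] (fromList xs))))

x∈p─q⁺ : ∀ {k} {x : Fin k} {p q : Subset k} → x ∈ₛ p → x ∉ₛ q → x ∈ₛ p ─ q
x∈p─q⁺ {q = true ∷ q}  Vec.here      x∉q = ⊥-elim (x∉q Vec.here)
x∈p─q⁺ {q = false ∷ q} Vec.here      x∉q = Vec.here
x∈p─q⁺ {q = _ ∷ q}     (Vec.there x∈p) x∉q = Vec.there (x∈p─q⁺ x∈p (x∉q ∘ Vec.there))

Unique-reverse : ∀ {A : Set} {xs : List A} → Unique xs → Unique (reverse xs)
Unique-reverse {A} {xs} = PermutationSetoid.Unique-resp-↭ (≡.setoid A) (↭⇒↭ₛ (↭-sym (↭-reverse xs)))

module _ (G : Graph) where

  Walk-head : ∀ {u v vs} → Walk G u v vs → u ∈ vs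
  Walk-head here       = here refl
  Walk-head (step _ _) = here refl

  Walk-last : ∀ {u v vs} → Walk G u v vs → v ∈ vs
  Walk-last here          = here refl
  Walk-last (step _ walk) = there (Walk-last walk)

  Walk-snoc : ∀ {u v w vs} → Walk G u v vs → Adj G v w → Walk G u w (vs ∷ʳ w)
  Walk-snoc here          e = step e here
  Walk-snoc (step e′ walk) e = step e′ (Walk-snoc walk e)

  Walk-reverse : ∀ {u v vs} → Walk G u v vs → Walk G v u (reverse vs)
  Walk-reverse here = here
  Walk-reverse (step {u} {w} {v} {vs} e walk) =
    ≡.subst (Walk G v u) (≡.sym (unfold-reverse u vs))
      (Walk-snoc (Walk-reverse walk) (≡.trans (Graph.sym G w u) e))

  Walk-prefix : ∀ {x y z vs} → Walk G x y vs → Unique vs → z ∈ vs →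
                ∃[ ps ] Walk G x z ps × Unique ps × length ps ≤ length vs × ps ⊆ vs
  Walk-prefix here       _ (here refl) = _ , here , [] ∷ [] , ≤-refl , id
  Walk-prefix (step e w) _ (here refl) = _ , here , [] ∷ [] , s≤s z≤n , λ { (here refl) → here refl }
  Walk-prefix (step e w) (x∉ ∷ uvs) (there z∈) with Walk-prefix w uvs z∈
  ... | ps , prefix , ups , short , ps⊆vs =
    _ ∷ ps , step e prefix , All.tabulate (All.lookup x∉ ∘ ps⊆vs) ∷ ups , s≤s short ,
    λ { (here refl) → here refl ; (there t∈) → there (ps⊆vs t∈) }

  ShortPath-prefix : ∀ {d x y z vs} → ShortPath G d x y vs → z ∈ vs →
                     ∃[ ps ] ShortPath G d x z ps × ps ⊆ vs
  ShortPath-prefix (walk , uvs , short) z∈ with Walk-prefix walk uvs z∈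
  ... | ps , prefix , ups , shorter , ps⊆vs = ps , (prefix , ups , ≤-trans shorter short) , ps⊆vs

  ShortPath-reverse : ∀ {d u v vs} → ShortPath G d u v vs → ShortPath G d v u (reverse vs)
  ShortPath-reverse {vs = vs} (walk , uvs , short) =
    Walk-reverse walk , Unique-reverse uvs , ≤-trans (≤-reflexive (length-reverse vs)) short

  module _ (σ : Order G) where

    WReach-self : ∀ d u → WReach G d σ u u
    WReach-self d u = ≤-refl , u ∷ [] , (here , [] ∷ [] , s≤s z≤n) , ≤-refl ∷ []

    path-minimum⇒WReach : ∀ {d x y z vs} → ShortPath G d x y vs → z ∈ vs → All (OrdLe G σ z) vs →
                          WReach G d σ x z
    path-minimum⇒WReach path@(walk , _) z∈ z-min with ShortPath-prefix path z∈
    ... | ps , prefix , ps⊆vs =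
      All.lookup z-min (Walk-head walk) , ps , prefix , All.tabulate (All.lookup z-min ∘ ps⊆vs)

    ShortPath⇒common-WReach : ∀ {d x y vs} → ShortPath G d x y vs →
                              ∃[ z ] z ∈ vs × WReach G d σ x z × WReach G d σ y z
    ShortPath⇒common-WReach {vs = []} (() , _)
    ShortPath⇒common-WReach {vs = v ∷ vs} path =
      z , z∈ , path-minimum⇒WReach path z∈ z-min ,
      path-minimum⇒WReach (ShortPath-reverse path) (Any.reverse⁺ z∈) (All-resp-↭ (↭-sym (↭-reverse _)) z-min)
      where
      rank : V G → ℕ
      rank x = toℕ (σ ⟨$⟩ʳ x)
      z = argmin rank v vs
      z∈ : z ∈ v ∷ vs
      z∈ with argmin-sel rank v vs
      ... | inj₁ z≡v  = here z≡v
      ... | inj₂ z∈vs = there z∈vs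
      z-min : All (OrdLe G σ z) (v ∷ vs)
      z-min = f[argmin]≤f[⊤] {f = rank} v vs ∷ f[argmin]≤f[xs] {f = rank} v vs

wcol≤⇒quasiWide : ∀ {G d k} (σ : Order G) → WcolOrdLe G d σ k → ∀ m (A : Subset (n G)) →
                  margin k m ≤ ∣ A ∣ →
                  ∃[ S ] ∃[ B ] ∣ S ∣ ≤ k × B ⊆ₛ (A ─ S) × m ≤ ∣ B ∣ × DistIndep G d S B
wcol≤⇒quasiWide {G} {d} {k} σ bound m A big =
  S , B , ∣S∣≤k , B⊆A─S , ≤-trans members-large (length≤∣fromList∣ members-unique) , independent
  where
  W : V G → List (V G)
  W u = proj₁ (bound u)
  W-covers : ∀ {u v} → WReach G d σ u v → v ∈ W u
  W-covers {u} {v} = proj₂ (proj₂ (bound u)) v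
  family : Family _≟_ W (toList A) k
  family = record
    { distinct = toList-unique A
    ; reflexive = λ _ → W-covers (WReach-self G σ d _)
    ; bounded = λ {u} _ → proj₁ (proj₂ (bound u))
    }
  separation : Separated _≟_ W (toList A) k m
  separation = separated _≟_ m k family (≤-trans big (≤-reflexive (∣p∣≡length[toList] A)))
  open Separated separation
  S = fromList separator
  B = fromList members
  ∈B⁻ : ∀ {x} → x ∈ₛ B → x ∈ members
  ∈B⁻ = ∈-fromList⁻ members
  ∣S∣≤k : ∣ S ∣ ≤ k
  ∣S∣≤k = ≤-trans (∣fromList∣≤length separator) separator-small
  B⊆A─S : B ⊆ₛ (A ─ S)
  B⊆A─S x∈B = x∈p─q⁺ (∈-toList⁻ A (members⊆L (∈B⁻ x∈B))) (members-avoid (∈B⁻ x∈B) ∘ ∈-fromList⁻ separator)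
  independent : DistIndep G d S B
  independent x y x∈B y∈B x≢y (vs , path , avoids) with ShortPath⇒common-WReach G σ path
  ... | z , z∈vs , x⇝z , y⇝z = All.lookup avoids z∈vs
    (∈-fromList⁺ (separates (∈B⁻ x∈B) (∈B⁻ y∈B) x≢y (W-covers x⇝z) (W-covers y⇝z)))

lemma6p17 : (C : Class) (w : ℕ → ℕ) →
    (∀ d → 1 ≤ d → IsWcolClass C d (w d)) →
    UQWWith M2D1 C (λ m d → (w d) ! * (m + 1) ^ (w d + 1)) w
lemma6p17 C w wcol m d (_ , 1≤d) G G∈C with proj₁ (wcol d 1≤d) G G∈C
... | σ , bound = wcol≤⇒quasiWide σ bound m
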